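{- Let $\mathrm{Bag}:=(\mathrm{FinSet}\triangleleft\mathrm{El})$, where $\mathrm{FinSet}:=\sum_{X:\mathsf{Type}}\sum_{n:\mathbb N}\lVert X\simeq\mathrm{Fin}(n)\rVert$ and $\mathrm{El}$ is the first projection. Then there is an equivalence of containers $\partial\,\mathrm{Bag}\simeq\mathrm{Bag}$.
   Context: Work in Homotopy Type Theory with a univalent universe $\mathsf{Type}$ (the shapes of $\mathrm{Bag}$ live in a higher universe, or can be replaced by an equivalent small type). $\mathrm{Fin}(n)$ is the standard finite type with $n$ elements and $\lVert-\rVert$ is propositional truncation. A point $a:A$ is isolated if $a=b$ is decidable for all $b:A$; $A^{\circ}$ is the subtype of isolated points and $A\setminus a:=\sum_{b:A}\neg(a=b)$. A container $(S\triangleleft P)$ has shapes $S$ and positions $P:S\to\mathsf{Type}$. A cartesian morphism $(S\triangleleft P)\multimap(T\triangleleft Q)$ is $(f,u)$ with $f:S\to T$, $u:\prod_sQ_{fs}\simeq P_s$; it is an equivalence of containers if $f$ is an equivalence. The derivative is $\partial(S\triangleleft P):=((s,p):\sum_s(P_s)^{\circ}\triangleleft P_s\setminus p)$. -}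

{-# OPTIONS --without-K #-}
module Defs where

-- Minimal HoTT vocabulary, stated over the standard library.
-- Type = Set (= Set₀); --without-K is essential (K contradicts univalence).

open import Level using (Level; _⊔_; zero; Setω) renaming (suc to lsuc)
open import Data.Nat using (ℕ)
open import Data.Fin using (Fin)
open import Data.Product using (Σ; Σ-syntax; _,_; proj₁; proj₂)
open import Relation.Nullary using (¬_; Dec)
open import Relation.Binary.PropositionalEquality using (_≡_; refl)

private variable
  ℓ ℓ' ℓ'' : Level

isContr : Set ℓ → Set ℓ
isContr A = Σ[ a ∈ A ] ((b : A) → a ≡ b)

isProp : Set ℓ → Set ℓ
isProp A = (a b : A) → a ≡ b

fiber : {A : Set ℓ} {B : Set ℓ'} → (A → B) → B → Set (ℓ ⊔ ℓ')
fiber {A = A} f b = Σ[ a ∈ A ] (f a ≡ b)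

isEquiv : {A : Set ℓ} {B : Set ℓ'} → (A → B) → Set (ℓ ⊔ ℓ')
isEquiv {B = B} f = (b : B) → isContr (fiber f b)

infix 4 _≃_
_≃_ : Set ℓ → Set ℓ' → Set (ℓ ⊔ ℓ')
A ≃ B = Σ[ f ∈ (A → B) ] isEquiv f

idEquiv : (A : Set ℓ) → A ≃ A
idEquiv A = (λ a → a) , λ b → (b , refl) , λ { (a , refl) → refl }

idtoeqv : {A B : Set ℓ} → A ≡ B → A ≃ B
idtoeqv {A = A} refl = idEquiv A

Univalence : Set₁
Univalence = (A B : Set) → isEquiv (idtoeqv {A = A} {B = B})

-- function extensionality (a consequence of univalence; included for convenience)
FunExt : Setω
FunExt = ∀ {ℓ ℓ'} {A : Set ℓ} {B : A → Set ℓ'} {f g : (a : A) → B a}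
         → ((a : A) → f a ≡ g a) → f ≡ g

record PropTrunc : Setω where
  field
    ∥_∥    : Set → Set
    ∣_∣    : {A : Set} → A → ∥ A ∥
    squash : {A : Set} → isProp ∥ A ∥
    rec    : ∀ {ℓ} {A : Set} {B : Set ℓ} → isProp B → (A → B) → ∥ A ∥ → B

isIsolated : {A : Set ℓ} → A → Set ℓ
isIsolated {A = A} a = (b : A) → Dec (a ≡ b)

_° : Set ℓ → Set ℓ
A ° = Σ[ a ∈ A ] isIsolated a

_∖_ : (A : Set ℓ) → A → Set ℓ
A ∖ a = Σ[ b ∈ A ] ¬ (a ≡ b)

record Container (s p : Level) : Set (lsuc (s ⊔ p)) where
  constructor _◁_
  field
    Shape : Set s
    Pos   : Shape → Set p
open Container public

_⊸_ : ∀ {s p t q} → Container s p → Container t q → Set (s ⊔ p ⊔ t ⊔ q)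
C ⊸ D = Σ[ f ∈ (Shape C → Shape D) ] ((s : Shape C) → Pos D (f s) ≃ Pos C s)

_≃ᶜ_ : ∀ {s p t q} → Container s p → Container t q → Set (s ⊔ p ⊔ t ⊔ q)
C ≃ᶜ D = Σ[ m ∈ (C ⊸ D) ] isEquiv (proj₁ m)

∂ : ∀ {s p} → Container s p → Container (s ⊔ p) p
∂ (S ◁ P) = (Σ[ s ∈ S ] (P s) °) ◁ λ { (s , (p , _)) → P s ∖ p }

module _ (T : PropTrunc) where
  open PropTrunc T

  FinSet : Set₁
  FinSet = Σ[ X ∈ Set ] Σ[ n ∈ ℕ ] ∥ X ≃ Fin n ∥

  El : FinSet → Set
  El = proj₁

  Bag : Container (lsuc zero) zero
  Bag = FinSet ◁ El

{-# OPTIONS --without-K #-}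

-- Removing an isolated point x from a finite set X of cardinality n gives a finite set
-- X ∖ x of cardinality n - 1, and adjoining a fresh point to a finite set Y gives a
-- finite set ⊤ ⊎ Y in which the new point is isolated. These two constructions are
-- mutually inverse up to univalence, because an isolated point splits X as ⊤ ⊎ (X ∖ x);
-- being isolated and being finite are propositions, so they impose no further
-- coherence. Along the first map the positions X ∖ x of ∂ Bag are literally the
-- positions of Bag, so the position equivalences are identities.

module Submission where

open import Defs
open import Level using (Level)
open import Data.Empty using (⊥-elim)
open import Data.Fin using (Fin; punchIn; punchOut)
open import Data.Fin.Properties using (1↔⊤; +↔⊎; punchInᵢ≢i; punchIn-punchOut; punchOut-punchIn)
open import Data.Nat using (ℕ; zero; suc; pred)
open import Data.Nat.Properties using (≡-irrelevant)
open import Data.Product using (_,_; proj₁; proj₂)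
open import Data.Sum using (_⊎_; inj₁; inj₂)
open import Data.Sum.Function.Propositional using (_⊎-↔_)
open import Data.Unit using (⊤; tt)
open import Function.Bundles using (Inverse; _↔_; mk↔ₛ′)
open import Function.Construct.Composition using (_↔-∘_)
open import Function.Construct.Symmetry using (↔-sym)
import Function.Properties.Inverse.HalfAdjointEquivalence as HalfAdjoint
open import Relation.Nullary using (¬_; Dec; yes; no)
open import Relation.Nullary.Decidable using (recompute; recompute-constant)
open import Relation.Nullary.Irrelevant using (Irrelevant)
open import Relation.Binary.PropositionalEquality
  using (_≡_; refl; sym; trans; cong; cong₂; subst; trans-symˡ; module ≡-Reasoning)

private variable
  a b : Level
  A : Set a
  B : Set b

↔⇒isEquiv : (e : A ↔ B) → isEquiv (Inverse.to e)
↔⇒isEquiv e y = centre y , contraction y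
  where
  open HalfAdjoint._≃_ (HalfAdjoint.↔⇒≃ e)

  centre : ∀ y → fiber to y
  centre y = from y , right-inverse-of y

  fibre-path : ∀ {x x′} (q : x′ ≡ x) → _≡_ {A = fiber to (to x)} (x′ , cong to q) (x , refl)
  fibre-path refl = refl

  contraction : ∀ y (φ : fiber to y) → centre y ≡ φ
  contraction .(to x) (x , refl) =
    subst (λ p → (from (to x) , p) ≡ (x , refl)) (left-right x) (fibre-path (left-inverse-of x))

↔⇒≃ : A ↔ B → A ≃ B
↔⇒≃ e = Inverse.to e , ↔⇒isEquiv e

≃⇒↔ : A ≃ B → A ↔ B
≃⇒↔ (f , f-equiv) = mk↔ₛ′ f
  (λ y → proj₁ (proj₁ (f-equiv y)))
  (λ y → proj₂ (proj₁ (f-equiv y)))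
  (λ x → cong proj₁ (proj₂ (f-equiv (f x)) (x , refl)))

isIsolated⇒≡-irrelevant : {x : A} → isIsolated x → ∀ y → Irrelevant (x ≡ y)
isIsolated⇒≡-irrelevant {x = x} x? y p q = begin
  p                                          ≡⟨ sym (canonical p) ⟩
  trans (sym (normalise refl)) (normalise p) ≡⟨ cong (trans _) (recompute-constant (x? y) p q) ⟩
  trans (sym (normalise refl)) (normalise q) ≡⟨ canonical q ⟩
  q                                          ∎
  where
  open ≡-Reasoning
  -- Hedberg's argument, localised at x: decidability of x ≡ y gives a constant
  -- endofunction on x ≡ y, through which every path factors.
  normalise : ∀ {y} → x ≡ y → x ≡ y
  normalise {y} p = recompute (x? y) p

  canonical : ∀ {y} (p : x ≡ y) → trans (sym (normalise refl)) (normalise p) ≡ p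
  canonical refl = trans-symˡ (normalise refl)

module _ (fe : FunExt) where

  ¬-irrelevant : Irrelevant (¬ A)
  ¬-irrelevant ¬p ¬q = fe (λ p → ⊥-elim (¬p p))

  Dec-irrelevant : Irrelevant A → Irrelevant (Dec A)
  Dec-irrelevant irr (yes p) (yes q) = cong yes (irr p q)
  Dec-irrelevant irr (yes p) (no ¬q) = ⊥-elim (¬q p)
  Dec-irrelevant irr (no ¬p) (yes q) = ⊥-elim (¬p q)
  Dec-irrelevant irr (no ¬p) (no ¬q) = cong no (¬-irrelevant ¬p ¬q)

  isIsolated-irrelevant : {x : A} → Irrelevant (isIsolated x)
  isIsolated-irrelevant x? x?′ =
    fe (λ y → Dec-irrelevant (isIsolated⇒≡-irrelevant x? y) (x? y) (x?′ y))

  ∖-≡ : {x y y′ : A} {x≢y : ¬ x ≡ y} {x≢y′ : ¬ x ≡ y′} →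
        y ≡ y′ → _≡_ {A = A ∖ x} (y , x≢y) (y′ , x≢y′)
  ∖-≡ refl = cong (_ ,_) (¬-irrelevant _ _)

  ∖-cong : (e : A ↔ B) (x : A) → A ∖ x ↔ B ∖ Inverse.to e x
  ∖-cong e x = mk↔ₛ′
    (λ (y , x≢y) → to y , λ p → x≢y (injective p))
    (λ (z , ex≢z) → from z , λ p → ex≢z (trans (cong to p) (strictlyInverseˡ z)))
    (λ _ → ∖-≡ (strictlyInverseˡ _))
    (λ _ → ∖-≡ (strictlyInverseʳ _))
    where
    open Inverse e
    open HalfAdjoint._≃_ (HalfAdjoint.↔⇒≃ e) using (injective)

  Fin-suc∖↔ : ∀ {m} (i : Fin (suc m)) → Fin (suc m) ∖ i ↔ Fin m
  Fin-suc∖↔ i = mk↔ₛ′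
    (λ (j , i≢j) → punchOut i≢j)
    (λ j → punchIn i j , λ p → punchInᵢ≢i i j (sym p))
    (λ j → punchOut-punchIn i)
    (λ (j , i≢j) → ∖-≡ (punchIn-punchOut i≢j))

  ∖-Fin : {X : Set} {n : ℕ} (x : X) → X ↔ Fin n → X ∖ x ↔ Fin (pred n)
  ∖-Fin {n = zero}  x e with Inverse.to e x
  ... | ()
  ∖-Fin {n = suc m} x e = Fin-suc∖↔ (Inverse.to e x) ↔-∘ ∖-cong e x

  ⊤⊎∖inj₁↔ : (Y : Set) → (⊤ ⊎ Y) ∖ inj₁ tt ↔ Y
  ⊤⊎∖inj₁↔ Y = mk↔ₛ′
    (λ { (inj₁ tt , tt≢tt) → ⊥-elim (tt≢tt refl) ; (inj₂ y , _) → y })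
    (λ y → inj₂ y , λ ())
    (λ y → refl)
    (λ { (inj₁ tt , tt≢tt) → ⊥-elim (tt≢tt refl) ; (inj₂ y , _) → ∖-≡ refl })

  isolated-split↔ : {X : Set} {x : X} → isIsolated x → (⊤ ⊎ (X ∖ x)) ↔ X
  isolated-split↔ {X = X} {x} x? = mk↔ₛ′ join split join-split split-join
    where
    join : ⊤ ⊎ (X ∖ x) → X
    join (inj₁ tt)      = x
    join (inj₂ (y , _)) = y

    split : X → ⊤ ⊎ (X ∖ x)
    split y with x? y
    ... | yes _   = inj₁ tt
    ... | no x≢y  = inj₂ (y , x≢y)

    join-split : ∀ y → join (split y) ≡ y
    join-split y with x? y
    ... | yes x≡y = x≡y
    ... | no _    = refl

    split-join : ∀ z → split (join z) ≡ z
    split-join (inj₁ tt) with x? x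
    ... | yes _  = refl
    ... | no x≢x = ⊥-elim (x≢x refl)
    split-join (inj₂ (y , x≢y)) with x? y
    ... | yes x≡y = ⊥-elim (x≢y x≡y)
    ... | no _    = cong inj₂ (∖-≡ refl)

⊤⊎-isIsolated-inj₁ : {Y : Set} → isIsolated {A = ⊤ ⊎ Y} (inj₁ tt)
⊤⊎-isIsolated-inj₁ (inj₁ tt) = yes refl
⊤⊎-isIsolated-inj₁ (inj₂ _)  = no (λ ())

inhabited-Fin⇒suc-pred : {X : Set} {n : ℕ} → X → X ↔ Fin n → suc (pred n) ≡ n
inhabited-Fin⇒suc-pred {n = zero}  x e with Inverse.to e x
... | ()
inhabited-Fin⇒suc-pred {n = suc m} x e = refl

⊤⊎-Fin : {Y : Set} {m : ℕ} → Y ↔ Fin m → (⊤ ⊎ Y) ↔ Fin (suc m)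
⊤⊎-Fin {m = m} e = ↔-sym (+↔⊎ {1} {m}) ↔-∘ (↔-sym 1↔⊤ ⊎-↔ e)

module _ (univalence : Univalence) where

  ua : {X Y : Set} → X ≃ Y → X ≡ Y
  ua {X} {Y} e = proj₁ (proj₁ (univalence X Y e))

  subst-idtoeqv : {X Y : Set} (p : X ≡ Y) (x : X) → subst (λ Z → Z) p x ≡ proj₁ (idtoeqv p) x
  subst-idtoeqv refl x = refl

  ua-β : {X Y : Set} (e : X ≃ Y) (x : X) → subst (λ Z → Z) (ua e) x ≡ proj₁ e x
  ua-β {X} {Y} e x =
    trans (subst-idtoeqv (ua e) x) (cong (λ e′ → proj₁ e′ x) (proj₂ (proj₁ (univalence X Y e))))

module _ (T : PropTrunc) where
  open PropTrunc T

  ∥∥-map : {X Y : Set} → (X → Y) → ∥ X ∥ → ∥ Y ∥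
  ∥∥-map f = rec squash (λ x → ∣ f x ∣)

  FinSet-≡ : {X Y : Set} {n m : ℕ} {t : ∥ X ≃ Fin n ∥} {t′ : ∥ Y ≃ Fin m ∥} →
             X ≡ Y → n ≡ m → _≡_ {A = FinSet T} (X , n , t) (Y , m , t′)
  FinSet-≡ {t = t} {t′} refl refl = cong (λ t″ → _ , _ , t″) (squash t t′)

  ∂Bag-Shape : Set₁
  ∂Bag-Shape = Shape (∂ (Bag T))

  module _ (fe : FunExt) where

    ∂Bag-Shape-≡ :
      {X Y : Set} {n m : ℕ} {t : ∥ X ≃ Fin n ∥} {t′ : ∥ Y ≃ Fin m ∥}
      {x : X} {x? : isIsolated x} {y : Y} {y? : isIsolated y} →
      (p : X ≡ Y) → n ≡ m → subst (λ Z → Z) p x ≡ y →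
      _≡_ {A = ∂Bag-Shape} ((X , n , t) , (x , x?)) ((Y , m , t′) , (y , y?))
    ∂Bag-Shape-≡ {t = t} {t′} {x? = x?} {y? = y?} refl refl refl =
      cong₂ (λ t″ x?′ → (_ , _ , t″) , (_ , x?′)) (squash t t′) (isIsolated-irrelevant fe x? y?)

    -- pred n is a genuine predecessor, since X is inhabited by x.
    remove-point : ∂Bag-Shape → FinSet T
    remove-point ((X , n , t) , (x , _)) =
      X ∖ x , pred n , ∥∥-map (λ e → ↔⇒≃ (∖-Fin fe x (≃⇒↔ e))) t

    adjoin-point : FinSet T → ∂Bag-Shape
    adjoin-point (Y , m , t) =
      ((⊤ ⊎ Y) , suc m , ∥∥-map (λ e → ↔⇒≃ (⊤⊎-Fin (≃⇒↔ e))) t) , (inj₁ tt , ⊤⊎-isIsolated-inj₁)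

    module _ (univalence : Univalence) where

      remove-adjoin : ∀ S → remove-point (adjoin-point S) ≡ S
      remove-adjoin (Y , m , t) = FinSet-≡ (ua univalence (↔⇒≃ (⊤⊎∖inj₁↔ fe Y))) refl

      adjoin-remove : ∀ s → adjoin-point (remove-point s) ≡ s
      adjoin-remove ((X , n , t) , (x , x?)) =
        ∂Bag-Shape-≡ (ua univalence split) (rec ≡-irrelevant (λ e → inhabited-Fin⇒suc-pred x (≃⇒↔ e)) t)
          (ua-β univalence split (inj₁ tt))
        where
        split : (⊤ ⊎ (X ∖ x)) ≃ X
        split = ↔⇒≃ (isolated-split↔ fe x?)

      remove-point↔ : ∂Bag-Shape ↔ FinSet T
      remove-point↔ = mk↔ₛ′ remove-point adjoin-point remove-adjoin adjoin-remove

proposition3p15 : Univalence → FunExt → (T : PropTrunc) → ∂ (Bag T) ≃ᶜ Bag T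
proposition3p15 univalence fe T =
  (remove-point T fe , λ s → idEquiv _) , ↔⇒isEquiv (remove-point↔ T fe univalence)
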